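{- Let $n\ge3$ and $a,b$ be positive integers. If a $\mathrm{LC}(a^2b^{n-2})$ exists, then $a\le 2(n-2)b$.
   Context: A latin cube of order $N$ is an $N\times N\times N$ array on $N$ symbols such that any two cells whose coordinates differ in exactly one position contain different symbols; a subcube is an $m\times m\times m$ subarray (indices in each coordinate from chosen $m$-sets) that is itself a latin cube of order $m$; subcubes are disjoint if they share no index in any coordinate and no symbol. $\mathrm{LC}(a^2b^{n-2})$ denotes a latin cube of order $2a+(n-2)b$ with pairwise disjoint subcubes, two of order $a$ and $n-2$ of order $b$. -}

module Defs where

open import Data.Nat using (ℕ; _+_; _*_; _∸_; _<_; _<?_)
open import Data.Fin using (Fin; toℕ)
open import Data.Fin.Subset using (Subset; _∈_; _∩_; ∣_∣; Empty)
open import Relation.Binary.PropositionalEquality using (_≡_; _≢_)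
open import Relation.Nullary using (yes; no)

Cube : ℕ → Set
Cube N = Fin N → Fin N → Fin N → Fin N

IsLatinCube : {N : ℕ} → Cube N → Set
IsLatinCube {N} L =
  (∀ x x' y z → x ≢ x' → L x y z ≢ L x' y z) ×' 
  ((∀ x y y' z → y ≢ y' → L x y z ≢ L x y' z) ×'
   (∀ x y z z' → z ≢ z' → L x y z ≢ L x y z'))
  where
  open import Data.Product using () renaming (_×_ to _×'_)

-- A subcube of order m of the cube L: index m-sets in each of the three
-- coordinates and an m-set of symbols such that the subarray only uses
-- those m symbols (hence, L being latin, it is a latin cube of order m
-- on those symbols).
record Subcube {N : ℕ} (L : Cube N) (m : ℕ) : Set where
  field
    rows cols files syms : Subset N
    ∣rows∣  : ∣ rows ∣ ≡ m
    ∣cols∣  : ∣ cols ∣ ≡ m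
    ∣files∣ : ∣ files ∣ ≡ m
    ∣syms∣  : ∣ syms ∣ ≡ m
    closed  : ∀ x y z → x ∈ rows → y ∈ cols → z ∈ files → L x y z ∈ syms

Disjoint : {N m m' : ℕ} {L : Cube N} → Subcube L m → Subcube L m' → Set
Disjoint S T =
  Empty (Subcube.rows S ∩ Subcube.rows T) ×'
  (Empty (Subcube.cols S ∩ Subcube.cols T) ×'
  (Empty (Subcube.files S ∩ Subcube.files T) ×'
   Empty (Subcube.syms S ∩ Subcube.syms T)))
  where
  open import Data.Product using () renaming (_×_ to _×'_)

subOrder : {n : ℕ} → ℕ → ℕ → Fin n → ℕ
subOrder a b i with toℕ i <? 2
... | yes _ = a
... | no  _ = b

-- LC(a^2 b^(n-2)): a latin cube of order 2a+(n-2)b with n pairwise disjoint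
-- subcubes, two of order a and n-2 of order b.
record LC (n a b : ℕ) : Set where
  field
    cube     : Cube (2 * a + (n ∸ 2) * b)
    latin    : IsLatinCube cube
    sub      : (i : Fin n) → Subcube cube (subOrder a b i)
    disjoint : (i j : Fin n) → i ≢ j → Disjoint (sub i) (sub j)

-- Let S₁, S₂ be the two subcubes of order a (rows Rᵢ, columns Cᵢ, files Fᵢ,
-- symbols Σᵢ) in the latin cube L of order 2a + m, m = (n-2)b > 0, and fix a
-- file z₀ outside F₁ ∪ F₂.  In a latin cube a symbol of Sᵢ placed in a cell
-- of Rᵢ × Cᵢ lies in a file of Fᵢ, so in the layer z₀:
--   * a row x ∈ R₁ meets no symbol of Σ₁ in the a columns C₁, hence at least
--     a - m symbols of Σ₂ (only m symbols lie outside Σ₁ ∪ Σ₂);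
--   * a symbol t ∈ Σ₂ occurs in the columns C₂ in a distinct rows outside R₂,
--     and in the columns C₁ in yet other rows; those in R₁ are also outside R₂,
--     so t occurs at most (a + m) - a = m times in R₁ × C₁.
-- Double counting the cells of R₁ × C₁ carrying a symbol of Σ₂ gives
-- a (a - m) ≤ a m, i.e. a ≤ 2m.

module Submission where

open import Defs
open import Data.Nat using (ℕ; zero; suc; _+_; _*_; _∸_; _≤_; _<_; z≤n; s≤s)
open import Data.Nat.Properties
  using ( +-*-semiring; +-assoc; +-comm; +-identityʳ; +-suc; *-assoc; +-mono-≤; +-monoˡ-≤; +-monoʳ-≤
        ; +-cancelʳ-≤; *-cancelˡ-≤; ≤-refl; ≤-reflexive; ≤-trans; <-irrefl; >⇒≢; m≤m+n; m≤n+m∸n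
        ; m≤n+o⇒m∸n≤o; m+n∸m≡n; module ≤-Reasoning)
open import Algebra.Properties.Semiring.Sum +-*-semiring
  using (sum; sum-syntax; ∑-comm; sum-cong-≗; *-distribˡ-sum)
open import Data.Bool using (if_then_else_)
open import Data.Fin using (Fin; zero; suc; _≟_)
open import Data.Fin.Properties using (suc-injective)
open import Data.Fin.Subset
  using (Subset; inside; outside; _∈_; _∉_; _⊆_; _⊂_; _∩_; _∪_; ∁; ⊥; ⁅_⁆; ∣_∣; ⊤; Empty; Nonempty)
open import Data.Fin.Subset.Properties
open import Data.Vec using ([]; _∷_; here; there)
open import Data.Product using (_×_; _,_; proj₁; proj₂; ∃-syntax)
open import Data.Sum using (inj₁; inj₂; [_,_]′)
open import Function using (_∘_; _⇔_; mk⇔; Equivalence; Injective)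
open import Relation.Nullary using (yes; no; does; contradiction)
open import Relation.Nullary.Decidable using (decidable-stable)
open import Relation.Binary.PropositionalEquality
  using (_≡_; refl; sym; trans; cong; cong₂; subst; subst₂; module ≡-Reasoning)

private variable
  n m : ℕ

[_∈_] : Fin n → Subset n → ℕ
[ x ∈ p ] = if does (x ∈? p) then 1 else 0

[∈]-cong : ∀ {x : Fin n} {y : Fin m} {p q} → x ∈ p ⇔ y ∈ q → [ x ∈ p ] ≡ [ y ∈ q ]
[∈]-cong {x = x} {y} {p} {q} x∈p⇔y∈q with x ∈? p | y ∈? q
... | yes _   | yes _   = refl
... | no  _   | no  _   = refl
... | yes x∈p | no y∉q  = contradiction (Equivalence.to x∈p⇔y∈q x∈p) y∉q
... | no  x∉p | yes y∈q = contradiction (Equivalence.from x∈p⇔y∈q y∈q) x∉p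

∑∈ : Subset n → (Fin n → ℕ) → ℕ
∑∈ p f = ∑[ x < _ ] ([ x ∈ p ] * f x)

syntax ∑∈ p (λ x → e) = ∑[ x ∈ p ] e

∑-mono-≤ : {f g : Fin n → ℕ} → (∀ i → f i ≤ g i) → sum f ≤ sum g
∑-mono-≤ {zero}  _   = z≤n
∑-mono-≤ {suc n} f≤g = +-mono-≤ (f≤g zero) (∑-mono-≤ (f≤g ∘ suc))

∑∈-mono-≤ : ∀ (p : Subset n) {f g} → (∀ {x} → x ∈ p → f x ≤ g x) → ∑∈ p f ≤ ∑∈ p g
∑∈-mono-≤ p f≤g = ∑-mono-≤ (λ x → [∈]*-mono-≤ x p f≤g)
  where
  [∈]*-mono-≤ : ∀ x p {a b} → (x ∈ p → a ≤ b) → [ x ∈ p ] * a ≤ [ x ∈ p ] * b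
  [∈]*-mono-≤ x p a≤b with x ∈? p
  ... | yes x∈p = +-monoˡ-≤ 0 (a≤b x∈p)
  ... | no  _   = z≤n

∑∈-const : (p : Subset n) (α : ℕ) → ∑[ x ∈ p ] α ≡ ∣ p ∣ * α
∑∈-const []            α = refl
∑∈-const (inside ∷ p)  α = cong₂ _+_ (+-identityʳ α) (∑∈-const p α)
∑∈-const (outside ∷ p) α = ∑∈-const p α

∣p∩q∣≡∑∈[∈] : (p q : Subset n) → ∣ p ∩ q ∣ ≡ ∑[ x ∈ p ] [ x ∈ q ]
∣p∩q∣≡∑∈[∈] []            []            = refl
∣p∩q∣≡∑∈[∈] (inside ∷ p)  (inside ∷ q)  = cong suc (∣p∩q∣≡∑∈[∈] p q)
∣p∩q∣≡∑∈[∈] (inside ∷ p)  (outside ∷ q) = ∣p∩q∣≡∑∈[∈] p q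
∣p∩q∣≡∑∈[∈] (outside ∷ p) (_ ∷ q)       = ∣p∩q∣≡∑∈[∈] p q

∣p∣*α≤∑∈ : ∀ (p : Subset n) {α} f → (∀ {x} → x ∈ p → α ≤ f x) → ∣ p ∣ * α ≤ ∑∈ p f
∣p∣*α≤∑∈ p {α} f α≤f = subst (_≤ ∑∈ p f) (∑∈-const p α) (∑∈-mono-≤ p α≤f)

∑∈≤∣p∣*β : ∀ (p : Subset n) {β} f → (∀ {x} → x ∈ p → f x ≤ β) → ∑∈ p f ≤ ∣ p ∣ * β
∑∈≤∣p∣*β p {β} f f≤β = subst (∑∈ p f ≤_) (∑∈-const p β) (∑∈-mono-≤ p f≤β)

double-counting : ∀ (p : Subset n) (q : Subset m) (R : Fin n → Subset m) (C : Fin m → Subset n) →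
                  (∀ {x t} → x ∈ p → t ∈ q → t ∈ R x ⇔ x ∈ C t) →
                  ∑[ x ∈ p ] ∣ q ∩ R x ∣ ≡ ∑[ t ∈ q ] ∣ p ∩ C t ∣
double-counting {n} {m} p q R C R⇔C = begin
  ∑[ x ∈ p ] ∣ q ∩ R x ∣
    ≡⟨ sum-cong-≗ (λ x → cong ([ x ∈ p ] *_) (∣p∩q∣≡∑∈[∈] q (R x))) ⟩
  ∑[ x < n ] ([ x ∈ p ] * ∑[ t ∈ q ] [ t ∈ R x ])
    ≡⟨ sum-cong-≗ (λ x → *-distribˡ-sum [ x ∈ p ] (λ t → [ t ∈ q ] * [ t ∈ R x ])) ⟩
  ∑[ x < n ] ∑[ t < m ] ([ x ∈ p ] * ([ t ∈ q ] * [ t ∈ R x ]))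
    ≡⟨ ∑-comm (λ x t → [ x ∈ p ] * ([ t ∈ q ] * [ t ∈ R x ])) ⟩
  ∑[ t < m ] ∑[ x < n ] ([ x ∈ p ] * ([ t ∈ q ] * [ t ∈ R x ]))
    ≡⟨ sum-cong-≗ (λ t → sum-cong-≗ (λ x → incidence x t)) ⟩
  ∑[ t < m ] ∑[ x < n ] ([ t ∈ q ] * ([ x ∈ p ] * [ x ∈ C t ]))
    ≡⟨ sum-cong-≗ (λ t → *-distribˡ-sum [ t ∈ q ] (λ x → [ x ∈ p ] * [ x ∈ C t ])) ⟨
  ∑[ t < m ] ([ t ∈ q ] * ∑[ x ∈ p ] [ x ∈ C t ])
    ≡⟨ sum-cong-≗ (λ t → cong ([ t ∈ q ] *_) (∣p∩q∣≡∑∈[∈] p (C t))) ⟨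
  ∑[ t ∈ q ] ∣ p ∩ C t ∣ ∎
  where
  open ≡-Reasoning
  incidence : ∀ x t → [ x ∈ p ] * ([ t ∈ q ] * [ t ∈ R x ]) ≡ [ t ∈ q ] * ([ x ∈ p ] * [ x ∈ C t ])
  incidence x t with x ∈? p | t ∈? q
  ... | yes x∈p | yes t∈q = cong (λ k → 1 * (1 * k)) ([∈]-cong (R⇔C x∈p t∈q))
  ... | yes _   | no  _   = refl
  ... | no  _   | yes _   = refl
  ... | no  _   | no  _   = refl

double-counting-≤ : ∀ (p : Subset n) (q : Subset m) (R : Fin n → Subset m) (C : Fin m → Subset n) →
                    (∀ {x t} → x ∈ p → t ∈ q → t ∈ R x ⇔ x ∈ C t) → ∀ {α β} →
                    (∀ {x} → x ∈ p → α ≤ ∣ q ∩ R x ∣) → (∀ {t} → t ∈ q → ∣ p ∩ C t ∣ ≤ β) →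
                    ∣ p ∣ * α ≤ ∣ q ∣ * β
double-counting-≤ p q R C R⇔C {α} {β} α≤ ≤β = begin
  ∣ p ∣ * α              ≤⟨ ∣p∣*α≤∑∈ p _ α≤ ⟩
  ∑[ x ∈ p ] ∣ q ∩ R x ∣ ≡⟨ double-counting p q R C R⇔C ⟩
  ∑[ t ∈ q ] ∣ p ∩ C t ∣ ≤⟨ ∑∈≤∣p∣*β q _ ≤β ⟩
  ∣ q ∣ * β              ∎
  where open ≤-Reasoning

∣p∪q∣+∣p∩q∣≡∣p∣+∣q∣ : (p q : Subset n) → ∣ p ∪ q ∣ + ∣ p ∩ q ∣ ≡ ∣ p ∣ + ∣ q ∣
∣p∪q∣+∣p∩q∣≡∣p∣+∣q∣ []            []            = refl
∣p∪q∣+∣p∩q∣≡∣p∣+∣q∣ (inside ∷ p)  (inside ∷ q)  =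
  cong suc (trans (+-suc _ _) (trans (cong suc (∣p∪q∣+∣p∩q∣≡∣p∣+∣q∣ p q)) (sym (+-suc _ _))))
∣p∪q∣+∣p∩q∣≡∣p∣+∣q∣ (inside ∷ p)  (outside ∷ q) = cong suc (∣p∪q∣+∣p∩q∣≡∣p∣+∣q∣ p q)
∣p∪q∣+∣p∩q∣≡∣p∣+∣q∣ (outside ∷ p) (inside ∷ q)  = trans (cong suc (∣p∪q∣+∣p∩q∣≡∣p∣+∣q∣ p q)) (sym (+-suc _ _))
∣p∪q∣+∣p∩q∣≡∣p∣+∣q∣ (outside ∷ p) (outside ∷ q) = ∣p∪q∣+∣p∩q∣≡∣p∣+∣q∣ p q

Empty⇒∣p∣≡0 : {p : Subset n} → Empty p → ∣ p ∣ ≡ 0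
Empty⇒∣p∣≡0 {n} empty = trans (cong ∣_∣ (Empty-unique empty)) (∣⊥∣≡0 n)

∣p∪q∣≤∣p∣+∣q∣ : (p q : Subset n) → ∣ p ∪ q ∣ ≤ ∣ p ∣ + ∣ q ∣
∣p∪q∣≤∣p∣+∣q∣ p q = subst (∣ p ∪ q ∣ ≤_) (∣p∪q∣+∣p∩q∣≡∣p∣+∣q∣ p q) (m≤m+n _ _)

∣p∪q∣≡∣p∣+∣q∣ : (p q : Subset n) → Empty (p ∩ q) → ∣ p ∪ q ∣ ≡ ∣ p ∣ + ∣ q ∣
∣p∪q∣≡∣p∣+∣q∣ p q p∩q≡∅ = begin
  ∣ p ∪ q ∣             ≡⟨ +-identityʳ _ ⟨
  ∣ p ∪ q ∣ + 0         ≡⟨ cong (∣ p ∪ q ∣ +_) (Empty⇒∣p∣≡0 p∩q≡∅) ⟨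
  ∣ p ∪ q ∣ + ∣ p ∩ q ∣ ≡⟨ ∣p∪q∣+∣p∩q∣≡∣p∣+∣q∣ p q ⟩
  ∣ p ∣ + ∣ q ∣         ∎
  where open ≡-Reasoning

∣p∣>0⇒Nonempty : {p : Subset n} → 0 < ∣ p ∣ → Nonempty p
∣p∣>0⇒Nonempty {p = p} ∣p∣>0 with nonempty? p
... | yes p≢∅ = p≢∅
... | no  p≡∅ = contradiction (Empty⇒∣p∣≡0 p≡∅) (>⇒≢ ∣p∣>0)

image : (Fin n → Fin m) → Subset n → Subset m
image f []            = ⊥
image f (inside ∷ p)  = ⁅ f zero ⁆ ∪ image (f ∘ suc) p
image f (outside ∷ p) = image (f ∘ suc) p

∈image⁺ : ∀ (f : Fin n → Fin m) {p x} → x ∈ p → f x ∈ image f p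
∈image⁺ f {inside ∷ p}  here        = x∈p∪q⁺ (inj₁ (x∈⁅x⁆ (f zero)))
∈image⁺ f {inside ∷ p}  (there x∈p) = x∈p∪q⁺ (inj₂ (∈image⁺ (f ∘ suc) x∈p))
∈image⁺ f {outside ∷ p} (there x∈p) = ∈image⁺ (f ∘ suc) x∈p

∈image⁻ : ∀ (f : Fin n → Fin m) p {t} → t ∈ image f p → ∃[ x ] x ∈ p × f x ≡ t
∈image⁻ f []            t∈⊥ = contradiction t∈⊥ ∉⊥
∈image⁻ f (inside ∷ p)  t∈  with x∈p∪q⁻ ⁅ f zero ⁆ (image (f ∘ suc) p) t∈
... | inj₁ t∈⁅f0⁆ = zero , here , sym (x∈⁅y⁆⇒x≡y (f zero) t∈⁅f0⁆)
... | inj₂ t∈img  = let x , x∈p , fx≡t = ∈image⁻ (f ∘ suc) p t∈img in suc x , there x∈p , fx≡t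
∈image⁻ f (outside ∷ p) t∈  = let x , x∈p , fx≡t = ∈image⁻ (f ∘ suc) p t∈ in suc x , there x∈p , fx≡t

InjectiveOn : (Fin n → Fin m) → Subset n → Set
InjectiveOn f p = ∀ {x y} → x ∈ p → y ∈ p → f x ≡ f y → x ≡ y

InjectiveOn-∷⁻ : ∀ {f : Fin (suc n) → Fin m} {s p} → InjectiveOn f (s ∷ p) → InjectiveOn (f ∘ suc) p
InjectiveOn-∷⁻ inj x∈p y∈p e = suc-injective (inj (there x∈p) (there y∈p) e)

∣image∣≡∣p∣ : ∀ (f : Fin n → Fin m) p → InjectiveOn f p → ∣ image f p ∣ ≡ ∣ p ∣
∣image∣≡∣p∣ {m = m} f [] _ = ∣⊥∣≡0 m
∣image∣≡∣p∣ f (inside ∷ p)  inj = begin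
  ∣ ⁅ f zero ⁆ ∪ image (f ∘ suc) p ∣     ≡⟨ ∣p∪q∣≡∣p∣+∣q∣ _ _ f0∉image ⟩
  ∣ ⁅ f zero ⁆ ∣ + ∣ image (f ∘ suc) p ∣ ≡⟨ cong₂ _+_ (∣⁅x⁆∣≡1 (f zero)) (∣image∣≡∣p∣ (f ∘ suc) p (InjectiveOn-∷⁻ inj)) ⟩
  suc ∣ p ∣                              ∎
  where
  open ≡-Reasoning
  f0∉image : Empty (⁅ f zero ⁆ ∩ image (f ∘ suc) p)
  f0∉image (t , t∈) with x∈p∩q⁻ ⁅ f zero ⁆ _ t∈
  ... | t∈⁅f0⁆ , t∈img with ∈image⁻ (f ∘ suc) p t∈img
  ... | x , x∈p , fx≡t with inj (there x∈p) here (trans fx≡t (x∈⁅y⁆⇒x≡y (f zero) t∈⁅f0⁆))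
  ... | ()
∣image∣≡∣p∣ f (outside ∷ p) inj = ∣image∣≡∣p∣ (f ∘ suc) p (InjectiveOn-∷⁻ inj)

image-disjoint : ∀ {f : Fin n → Fin m} {p q} → Injective _≡_ _≡_ f →
                 Empty (p ∩ q) → Empty (image f p ∩ image f q)
image-disjoint {f = f} {p} {q} inj p∩q≡∅ (t , t∈) with x∈p∩q⁻ (image f p) _ t∈
... | t∈fp , t∈fq with ∈image⁻ f p t∈fp | ∈image⁻ f q t∈fq
... | x , x∈p , fx≡t | y , y∈q , fy≡t =
  p∩q≡∅ (x , x∈p∩q⁺ (x∈p , subst (_∈ q) (inj (trans fy≡t (sym fx≡t))) y∈q))

injection⇒⊆image : ∀ (f : Fin n → Fin m) {p q} → (∀ {x} → x ∈ p → f x ∈ q) →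
                   InjectiveOn f p → ∣ q ∣ ≤ ∣ p ∣ → q ⊆ image f p
injection⇒⊆image f {p} {q} into inj ∣q∣≤∣p∣ {t} t∈q with t ∈? image f p
... | yes t∈img = t∈img
... | no  t∉img = contradiction ∣image∣<∣image∣ (<-irrefl refl)
  where
  image⊂q : image f p ⊂ q
  image⊂q = (λ s∈img → let x , x∈p , fx≡s = ∈image⁻ f p s∈img in subst (_∈ q) fx≡s (into x∈p))
          , t , t∈q , t∉img
  ∣image∣<∣image∣ : ∣ image f p ∣ < ∣ image f p ∣
  ∣image∣<∣image∣ = begin-strict
    ∣ image f p ∣ <⟨ p⊂q⇒∣p∣<∣q∣ image⊂q ⟩
    ∣ q ∣         ≤⟨ ∣q∣≤∣p∣ ⟩
    ∣ p ∣         ≡⟨ ∣image∣≡∣p∣ f p inj ⟨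
    ∣ image f p ∣ ∎
    where open ≤-Reasoning

module LatinCube {N : ℕ} {L : Cube N} (latin : IsLatinCube L) where

  injective₁ : ∀ {x x′ y z} → L x y z ≡ L x′ y z → x ≡ x′
  injective₁ e = decidable-stable (_ ≟ _) (λ x≢x′ → proj₁ latin _ _ _ _ x≢x′ e)

  injective₂ : ∀ {x y y′ z} → L x y z ≡ L x y′ z → y ≡ y′
  injective₂ e = decidable-stable (_ ≟ _) (λ y≢y′ → proj₁ (proj₂ latin) _ _ _ _ y≢y′ e)

  injective₃ : ∀ {x y z z′} → L x y z ≡ L x y z′ → z ≡ z′
  injective₃ e = decidable-stable (_ ≟ _) (λ z≢z′ → proj₂ (proj₂ latin) _ _ _ _ z≢z′ e)

  column-complete : ∀ y z t → ∃[ x ] L x y z ≡ t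
  column-complete y z t with ∈image⁻ (λ x → L x y z) ⊤ t∈image
    where
    t∈image : t ∈ image (λ x → L x y z) ⊤
    t∈image = injection⇒⊆image (λ x → L x y z) {⊤} (λ _ → ∈⊤) (λ _ _ → injective₁) ≤-refl ∈⊤
  ... | x , _ , Lxyz≡t = x , Lxyz≡t

  ∈syms⇒∈files : ∀ {k} (S : Subcube L k) {x y z} → x ∈ Subcube.rows S → y ∈ Subcube.cols S →
                 L x y z ∈ Subcube.syms S → z ∈ Subcube.files S
  ∈syms⇒∈files S {x} {y} {z} x∈rows y∈cols Lxyz∈syms
    with ∈image⁻ (L x y) files (injection⇒⊆image (L x y) into (λ _ _ → injective₃) ∣syms∣≤∣files∣ Lxyz∈syms)
    where
    open Subcube S
    into : ∀ {z′} → z′ ∈ files → L x y z′ ∈ syms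
    into = closed x y _ x∈rows y∈cols
    ∣syms∣≤∣files∣ : ∣ syms ∣ ≤ ∣ files ∣
    ∣syms∣≤∣files∣ = ≤-reflexive (trans ∣syms∣ (sym ∣files∣))
  ... | z′ , z′∈files , Lxyz′≡Lxyz = subst (_∈ Subcube.files S) (injective₃ Lxyz′≡Lxyz) z′∈files

n*[n∸m]≤n*m⇒n≤2*m : ∀ n m → n * (n ∸ m) ≤ n * m → n ≤ 2 * m
n*[n∸m]≤n*m⇒n≤2*m zero    m _  = z≤n
n*[n∸m]≤n*m⇒n≤2*m (suc n) m le = begin
  suc n                  ≤⟨ m≤n+m∸n (suc n) m ⟩
  m + (suc n ∸ m)        ≤⟨ +-monoʳ-≤ m (*-cancelˡ-≤ (suc n) le) ⟩
  m + m                  ≡⟨ cong (m +_) (+-identityʳ m) ⟨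
  2 * m                  ∎
  where open ≤-Reasoning

module TwoDisjointSubcubes {a m : ℕ} {L : Cube (2 * a + m)} (latin : IsLatinCube L)
                           (S₁ S₂ : Subcube L a) (S₁#S₂ : Disjoint S₁ S₂) (m>0 : 0 < m) where

  open LatinCube latin
  open Subcube
  open Subcube S₁ using () renaming (rows to R₁; cols to C₁; files to F₁; syms to Σ₁)
  open Subcube S₂ using () renaming (rows to R₂; cols to C₂; files to F₂; syms to Σ₂)

  R₁∩R₂≡∅ : Empty (R₁ ∩ R₂)
  R₁∩R₂≡∅ = proj₁ S₁#S₂

  C₁∩C₂≡∅ : Empty (C₁ ∩ C₂)
  C₁∩C₂≡∅ = proj₁ (proj₂ S₁#S₂)

  F₁∩F₂≡∅ : Empty (F₁ ∩ F₂)
  F₁∩F₂≡∅ = proj₁ (proj₂ (proj₂ S₁#S₂))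

  Σ₁∩Σ₂≡∅ : Empty (Σ₁ ∩ Σ₂)
  Σ₁∩Σ₂≡∅ = proj₂ (proj₂ (proj₂ S₁#S₂))

  N : ℕ
  N = 2 * a + m

  N≡a+a+m : 2 * a + m ≡ a + a + m
  N≡a+a+m = cong (λ k → a + k + m) (+-identityʳ a)

  ∣∁∣≡a+m : ∀ p → ∣ p ∣ ≡ a → ∣ ∁ p ∣ ≡ a + m
  ∣∁∣≡a+m p ∣p∣≡a = begin
    ∣ ∁ p ∣               ≡⟨ ∣∁p∣≡n∸∣p∣ p ⟩
    2 * a + m ∸ ∣ p ∣     ≡⟨ cong₂ _∸_ N≡a+a+m ∣p∣≡a ⟩
    a + a + m ∸ a         ≡⟨ cong (_∸ a) (+-assoc a a m) ⟩
    a + (a + m) ∸ a       ≡⟨ m+n∸m≡n a (a + m) ⟩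
    a + m                 ∎
    where open ≡-Reasoning

  ∣∁[p∪q]∣≡m : ∀ {p q} → ∣ p ∣ ≡ a → ∣ q ∣ ≡ a → Empty (p ∩ q) → ∣ ∁ (p ∪ q) ∣ ≡ m
  ∣∁[p∪q]∣≡m {p} {q} ∣p∣≡a ∣q∣≡a p∩q≡∅ = begin
    ∣ ∁ (p ∪ q) ∣               ≡⟨ ∣∁p∣≡n∸∣p∣ (p ∪ q) ⟩
    2 * a + m ∸ ∣ p ∪ q ∣       ≡⟨ cong₂ _∸_ N≡a+a+m (∣p∪q∣≡∣p∣+∣q∣ p q p∩q≡∅) ⟩
    a + a + m ∸ (∣ p ∣ + ∣ q ∣) ≡⟨ cong (λ k → a + a + m ∸ k) (cong₂ _+_ ∣p∣≡a ∣q∣≡a) ⟩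
    a + a + m ∸ (a + a)         ≡⟨ m+n∸m≡n (a + a) m ⟩
    m                           ∎
    where open ≡-Reasoning

  file-outside : ∃[ z ] z ∉ F₁ ∪ F₂
  file-outside with ∣p∣>0⇒Nonempty {p = ∁ (F₁ ∪ F₂)} (subst (0 <_) (sym ∣∁[F₁∪F₂]∣≡m) m>0)
    where
    ∣∁[F₁∪F₂]∣≡m : ∣ ∁ (F₁ ∪ F₂) ∣ ≡ m
    ∣∁[F₁∪F₂]∣≡m = ∣∁[p∪q]∣≡m (∣files∣ S₁) (∣files∣ S₂) F₁∩F₂≡∅
  ... | z , z∈∁[F₁∪F₂] = z , x∈∁p⇒x∉p z∈∁[F₁∪F₂]

  z₀ : Fin N
  z₀ = proj₁ file-outside

  z₀∉F₁ : z₀ ∉ F₁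
  z₀∉F₁ = proj₂ file-outside ∘ x∈p∪q⁺ ∘ inj₁

  z₀∉F₂ : z₀ ∉ F₂
  z₀∉F₂ = proj₂ file-outside ∘ x∈p∪q⁺ ∘ inj₂

  ℓ : Fin N → Fin N → Fin N
  ℓ x y = L x y z₀

  ℓ∉syms : ∀ {k} (S : Subcube L k) → z₀ ∉ files S → ∀ {x y} → x ∈ rows S → y ∈ cols S → ℓ x y ∉ syms S
  ℓ∉syms S z₀∉files x∈rows y∈cols = z₀∉files ∘ ∈syms⇒∈files S x∈rows y∈cols

  rowOf : Fin N → Fin N → Fin N
  rowOf t y = proj₁ (column-complete y z₀ t)

  ℓ-rowOf : ∀ t y → ℓ (rowOf t y) y ≡ t
  ℓ-rowOf t y = proj₂ (column-complete y z₀ t)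

  rowOf≡⇒ℓ≡ : ∀ {t x y} → rowOf t y ≡ x → ℓ x y ≡ t
  rowOf≡⇒ℓ≡ {t} {y = y} refl = ℓ-rowOf t y

  rowOf-injective : ∀ t → Injective _≡_ _≡_ (rowOf t)
  rowOf-injective t {y} {y′} e = injective₂ (begin
    ℓ (rowOf t y) y   ≡⟨ ℓ-rowOf t y ⟩
    t                 ≡⟨ ℓ-rowOf t y′ ⟨
    ℓ (rowOf t y′) y′ ≡⟨ cong (λ x → ℓ x y′) e ⟨
    ℓ (rowOf t y) y′  ∎)
    where open ≡-Reasoning

  ∈image-ℓ⇔∈image-rowOf : ∀ {p x t} → t ∈ image (ℓ x) p ⇔ x ∈ image (rowOf t) p
  ∈image-ℓ⇔∈image-rowOf {p} {x} {t} = mk⇔ to from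
    where
    to : t ∈ image (ℓ x) p → x ∈ image (rowOf t) p
    to t∈ with ∈image⁻ (ℓ x) p t∈
    ... | y , y∈p , ℓxy≡t =
      subst (_∈ image (rowOf t) p) (injective₁ (trans (ℓ-rowOf t y) (sym ℓxy≡t))) (∈image⁺ (rowOf t) y∈p)
    from : x ∈ image (rowOf t) p → t ∈ image (ℓ x) p
    from x∈ with ∈image⁻ (rowOf t) p x∈
    ... | y , y∈p , rowOf≡x =
      subst (_∈ image (ℓ x) p) (rowOf≡⇒ℓ≡ rowOf≡x) (∈image⁺ (ℓ x) y∈p)

  row-bound : ∀ {x} → x ∈ R₁ → a ∸ m ≤ ∣ Σ₂ ∩ image (ℓ x) C₁ ∣
  row-bound {x} x∈R₁ = m≤n+o⇒m∸n≤o a m (begin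
    a                                          ≡⟨ ∣cols∣ S₁ ⟨
    ∣ C₁ ∣                                     ≡⟨ ∣image∣≡∣p∣ (ℓ x) C₁ (λ _ _ → injective₂) ⟨
    ∣ image (ℓ x) C₁ ∣                         ≤⟨ p⊆q⇒∣p∣≤∣q∣ image⊆ ⟩
    ∣ ∁ (Σ₁ ∪ Σ₂) ∪ (Σ₂ ∩ image (ℓ x) C₁) ∣    ≤⟨ ∣p∪q∣≤∣p∣+∣q∣ (∁ (Σ₁ ∪ Σ₂)) _ ⟩
    ∣ ∁ (Σ₁ ∪ Σ₂) ∣ + ∣ Σ₂ ∩ image (ℓ x) C₁ ∣  ≡⟨ cong (_+ ∣ Σ₂ ∩ image (ℓ x) C₁ ∣) ∣∁[Σ₁∪Σ₂]∣≡m ⟩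
    m + ∣ Σ₂ ∩ image (ℓ x) C₁ ∣                ∎)
    where
    open ≤-Reasoning
    ∣∁[Σ₁∪Σ₂]∣≡m : ∣ ∁ (Σ₁ ∪ Σ₂) ∣ ≡ m
    ∣∁[Σ₁∪Σ₂]∣≡m = ∣∁[p∪q]∣≡m (∣syms∣ S₁) (∣syms∣ S₂) Σ₁∩Σ₂≡∅
    image∉Σ₁ : ∀ {t} → t ∈ image (ℓ x) C₁ → t ∉ Σ₁
    image∉Σ₁ t∈ with ∈image⁻ (ℓ x) C₁ t∈
    ... | y , y∈C₁ , ℓxy≡t = ℓ∉syms S₁ z₀∉F₁ x∈R₁ y∈C₁ ∘ subst (_∈ Σ₁) (sym ℓxy≡t)
    image⊆ : image (ℓ x) C₁ ⊆ ∁ (Σ₁ ∪ Σ₂) ∪ (Σ₂ ∩ image (ℓ x) C₁)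
    image⊆ {t} t∈ with t ∈? Σ₂
    ... | yes t∈Σ₂ = x∈p∪q⁺ (inj₂ (x∈p∩q⁺ (t∈Σ₂ , t∈)))
    ... | no  t∉Σ₂ = x∈p∪q⁺ (inj₁ (x∉p⇒x∈∁p ([ image∉Σ₁ t∈ , t∉Σ₂ ]′ ∘ x∈p∪q⁻ Σ₁ Σ₂)))

  column-bound : ∀ {t} → t ∈ Σ₂ → ∣ R₁ ∩ image (rowOf t) C₁ ∣ ≤ m
  column-bound {t} t∈Σ₂ = +-cancelʳ-≤ a _ _ (begin
    ∣ R₁ ∩ X₁ ∣ + a        ≡⟨ cong (∣ R₁ ∩ X₁ ∣ +_) ∣X₂∣≡a ⟨
    ∣ R₁ ∩ X₁ ∣ + ∣ X₂ ∣   ≡⟨ ∣p∪q∣≡∣p∣+∣q∣ (R₁ ∩ X₁) X₂ R₁∩X₁∩X₂≡∅ ⟨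
    ∣ (R₁ ∩ X₁) ∪ X₂ ∣     ≤⟨ p⊆q⇒∣p∣≤∣q∣ ⊆∁R₂ ⟩
    ∣ ∁ R₂ ∣               ≡⟨ ∣∁∣≡a+m R₂ (∣rows∣ S₂) ⟩
    a + m                  ≡⟨ +-comm a m ⟩
    m + a                  ∎)
    where
    open ≤-Reasoning
    X₁ X₂ : Subset N
    X₁ = image (rowOf t) C₁
    X₂ = image (rowOf t) C₂
    ∣X₂∣≡a : ∣ X₂ ∣ ≡ a
    ∣X₂∣≡a = trans (∣image∣≡∣p∣ (rowOf t) C₂ (λ _ _ → rowOf-injective t)) (∣cols∣ S₂)
    R₁∩X₁∩X₂≡∅ : Empty ((R₁ ∩ X₁) ∩ X₂)
    R₁∩X₁∩X₂≡∅ (x , x∈) with x∈p∩q⁻ (R₁ ∩ X₁) X₂ x∈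
    ... | x∈R₁∩X₁ , x∈X₂ = image-disjoint (rowOf-injective t) C₁∩C₂≡∅
                             (x , x∈p∩q⁺ (proj₂ (x∈p∩q⁻ R₁ X₁ x∈R₁∩X₁) , x∈X₂))
    R₁∩X₁∌R₂ : ∀ {x} → x ∈ R₁ ∩ X₁ → x ∉ R₂
    R₁∩X₁∌R₂ {x} x∈ x∈R₂ = R₁∩R₂≡∅ (x , x∈p∩q⁺ (proj₁ (x∈p∩q⁻ R₁ X₁ x∈) , x∈R₂))
    X₂∌R₂ : ∀ {x} → x ∈ X₂ → x ∉ R₂
    X₂∌R₂ x∈X₂ x∈R₂ with ∈image⁻ (rowOf t) C₂ x∈X₂
    ... | y , y∈C₂ , rowOf≡x = ℓ∉syms S₂ z₀∉F₂ x∈R₂ y∈C₂ (subst (_∈ Σ₂) (sym (rowOf≡⇒ℓ≡ rowOf≡x)) t∈Σ₂)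
    ⊆∁R₂ : (R₁ ∩ X₁) ∪ X₂ ⊆ ∁ R₂
    ⊆∁R₂ = x∉p⇒x∈∁p ∘ [ R₁∩X₁∌R₂ , X₂∌R₂ ]′ ∘ x∈p∪q⁻ _ _

  a≤2*m : a ≤ 2 * m
  a≤2*m = n*[n∸m]≤n*m⇒n≤2*m a m (subst₂ (λ r s → r * (a ∸ m) ≤ s * m) (∣rows∣ S₁) (∣syms∣ S₂)
    (double-counting-≤ R₁ Σ₂ (λ x → image (ℓ x) C₁) (λ t → image (rowOf t) C₁)
                       (λ _ _ → ∈image-ℓ⇔∈image-rowOf {C₁}) row-bound column-bound))

lemma18 : (n a b : ℕ) → 3 ≤ n → 0 < a → 0 < b → LC n a b → a ≤ 2 * (n ∸ 2) * b
lemma18 (suc (suc (suc k))) a b (s≤s (s≤s (s≤s _))) _ 0<b lc =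
  subst (a ≤_) (sym (*-assoc 2 (suc k) b)) (TwoDisjointSubcubes.a≤2*m latin S₁ S₂ S₁#S₂ 0<m)
  where
  open LC lc
  S₁ S₂ : Subcube cube a
  S₁ = sub zero
  S₂ = sub (suc zero)
  S₁#S₂ : Disjoint S₁ S₂
  S₁#S₂ = disjoint zero (suc zero) (λ ())
  0<m : 0 < suc k * b
  0<m = ≤-trans 0<b (m≤m+n b (k * b))
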